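{- SAP (as defined in the context) with a Pareto-conform psychological model and cost functions with Pareto dimension $k$ whose derivatives have Pareto dimension $\ell$ reduces to solving a multi-criteria shortest path problem with $k+\ell$ criteria on $G$ and scoring the result. That is, there are weight vectors $w(e)\in\mathbb{Q}^{k+\ell}$ for the edges of $G$ such that the set of $s$–$t$ paths whose total weight is not Pareto dominated by that of another $s$–$t$ path contains an optimal solution of SAP.
   Context: Setting (SAP). Let $G=(V,E)$ be a directed graph, $s,t\in V$, and $d>0$ a rational demand. Every edge $e$ has a cost function $\tau_e:\mathbb{Q}_{\ge 0}\to\mathbb{Q}_{>0}$ that is monotonically increasing and differentiable; all cost functions are considered only on $[0,d]$, and an inequality between functions means it holds for every $x\in[0,d]$. Paths are identified with their edge sets; for a set $A$ of edges, $\tau_A=\sum_{e\in A}\tau_e$ (zero if $A=\emptyset$) and $\tau'_A$ is its derivative. An original simple $s$–$t$ path $Q$ is fixed. An alternative is a simple $s$–$t$ path $P$. For $x\in[0,d]$ put $\mathcal{C}_P(x)=x\,\tau_{P\setminus Q}(x)+(d-x)\,\tau_{Q\setminus P}(d-x)+d\,\tau_{P\cap Q}(d)$. A psychological model assigns to every alternative $P$ a value $x_P\in[0,d]$, and $\mathcal{C}_P:=\mathcal{C}_P(x_P)$. SAP asks for an alternative minimizing $\mathcal{C}_P$. Dominance: $P_1\preceq P_2$ iff $\tau_{P_1}\le\tau_{P_2}$ and $\tau'_{P_1\cap Q}\le\tau'_{P_2\cap Q}$. The model is Pareto-conform if $P_1\preceq P_2$ implies $\mathcal{C}_{P_1}\le\mathcal{C}_{P_2}$.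 Standing assumption: no two different paths dominate each other mutually. Pareto dimension: a class $\mathcal{T}$ of functions on $[0,d]$ closed under addition has Pareto dimension $k$ if there is a map $p:\mathcal{T}\to\mathbb{Q}^k$ (a Pareto representation) such that $\tau_1\le\tau_2$ iff $p(\tau_1)\le p(\tau_2)$ componentwise, and $p(\tau_1+\tau_2)=p(\tau_1)+p(\tau_2)$. "Cost functions with Pareto dimension $k$ whose derivatives have Pareto dimension $\ell$" means all $\tau_e$ lie in such a class $\mathcal{T}$ with representation $p$, and the derivatives of functions in $\mathcal{T}$ form a class of Pareto dimension $\ell$ with representation $p'$. Multi-criteria shortest path problem with $m$ criteria: given edge weights $w(e)\in\mathbb{Q}^m$ and path weight $w(P)=\sum_{e\in P}w(e)$, compute all $s$–$t$ paths $P$ such that no other $s$–$t$ path $P'$ has $w(P')\le w(P)$ componentwise with $w(P')\neq w(P)$. Scoring a set of alternatives means computing $\mathcal{C}_P$ for each and choosing the best. -}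

module Defs where

open import Data.Nat using (ℕ)
open import Data.Fin using (Fin)
open import Data.Fin.Properties using (_≟_)
open import Data.Rational using (ℚ; 0ℚ; _+_; _*_; _-_; ∣_∣; _≤_; _<_)
open import Data.List using (List; []; _∷_; filter)
open import Data.List.Relation.Unary.Unique.Propositional using (Unique)
open import Data.Vec using (Vec; _++_; replicate; zipWith)
import Data.Vec.Relation.Binary.Pointwise.Inductive as PW
open import Data.Product using (Σ; _×_)
open import Relation.Nullary.Decidable using (does; ¬?)
open import Data.Bool using (if_then_else_)
open import Relation.Binary.PropositionalEquality using (_≡_)

_≤ᵥ_ : ∀ {k} → Vec ℚ k → Vec ℚ k → Set
u ≤ᵥ v = PW.Pointwise _≤_ u v

_+ᵥ_ : ∀ {k} → Vec ℚ k → Vec ℚ k → Vec ℚ k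
u +ᵥ v = zipWith _+_ u v

0ᵥ : ∀ {k} → Vec ℚ k
0ᵥ = replicate _ 0ℚ

FunLe : ℚ → (ℚ → ℚ) → (ℚ → ℚ) → Set
FunLe d f g = ∀ x → 0ℚ ≤ x → x ≤ d → f x ≤ g x

_⊕_ : (ℚ → ℚ) → (ℚ → ℚ) → (ℚ → ℚ)
(f ⊕ g) x = f x + g x

HasDerivOn : ℚ → (ℚ → ℚ) → (ℚ → ℚ) → Set
HasDerivOn d f f' =
  ∀ x → 0ℚ ≤ x → x ≤ d →
  ∀ ε → 0ℚ < ε →
  Σ ℚ λ δ → 0ℚ < δ ×
    (∀ y → 0ℚ ≤ y → y ≤ d → ∣ y - x ∣ < δ →
       ∣ f y - f x - f' x * (y - x) ∣ ≤ ε * ∣ y - x ∣)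

MonotoneOn : ℚ → (ℚ → ℚ) → Set
MonotoneOn d f = ∀ x y → 0ℚ ≤ x → x ≤ y → y ≤ d → f x ≤ f y

PositiveOn : ℚ → (ℚ → ℚ) → Set
PositiveOn d f = ∀ x → 0ℚ ≤ x → x ≤ d → 0ℚ < f x

record ParetoRep (d : ℚ) (k : ℕ) (T : (ℚ → ℚ) → Set) (p : (ℚ → ℚ) → Vec ℚ k) : Set₁ where
  field
    closed   : ∀ f g → T f → T g → T (f ⊕ g)
    order→   : ∀ f g → T f → T g → FunLe d f g → p f ≤ᵥ p g
    order←   : ∀ f g → T f → T g → p f ≤ᵥ p g → FunLe d f g
    additive : ∀ f g → T f → T g → p (f ⊕ g) ≡ p f +ᵥ p g

Derivs : ℚ → ((ℚ → ℚ) → Set) → (ℚ → ℚ) → Set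
Derivs d T g = Σ (ℚ → ℚ) λ f → T f × HasDerivOn d f g

record Digraph : Set where
  field
    nV  : ℕ
    nE  : ℕ
    src : Fin nE → Fin nV
    tgt : Fin nE → Fin nV

module _ (G : Digraph) where
  open Digraph G

  Path : Set
  Path = List (Fin nE)

  IsWalk : Fin nV → Fin nV → Path → Set
  IsWalk u v []       = u ≡ v
  IsWalk u v (e ∷ es) = (src e ≡ u) × IsWalk (tgt e) v es

  vertices : Fin nV → Path → List (Fin nV)
  vertices u []       = u ∷ []
  vertices u (e ∷ es) = u ∷ vertices (tgt e) es

  SimplePath : Fin nV → Fin nV → Path → Set
  SimplePath s t P = IsWalk s t P × Unique (vertices s P)

  open import Data.List.Membership.DecPropositional (_≟_ {nE}) using (_∈?_)

  -- edge-set difference and intersection (paths identified with edge sets)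
  _∖_ : Path → Path → Path
  P ∖ Q = filter (λ e → ¬? (e ∈? Q)) P

  _∩_ : Path → Path → Path
  P ∩ Q = filter (λ e → e ∈? Q) P

  sumFun : (Fin nE → ℚ → ℚ) → Path → ℚ → ℚ
  sumFun τ []       x = 0ℚ
  sumFun τ (e ∷ es) x = τ e x + sumFun τ es x

  sumVec : ∀ {m} → (Fin nE → Vec ℚ m) → Path → Vec ℚ m
  sumVec w []       = 0ᵥ
  sumVec w (e ∷ es) = w e +ᵥ sumVec w es

  costAt : (τ : Fin nE → ℚ → ℚ) (d : ℚ) (Q P : Path) (x : ℚ) → ℚ
  costAt τ d Q P x =
    x * sumFun τ (P ∖ Q) x + (d - x) * sumFun τ (Q ∖ P) (d - x)
      + d * sumFun τ (P ∩ Q) d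

  -- dominance P1 ⪯ P2, where τ' e is the derivative of τ e and
  -- τ'_A = Σ_{e∈A} τ'_e (the derivative of τ_A)
  Dominates : (τ τ' : Fin nE → ℚ → ℚ) (d : ℚ) (Q P₁ P₂ : Path) → Set
  Dominates τ τ' d Q P₁ P₂ =
    FunLe d (sumFun τ P₁) (sumFun τ P₂) ×
    FunLe d (sumFun τ' (P₁ ∩ Q)) (sumFun τ' (P₂ ∩ Q))

  reductionWeight : ∀ {k ℓ} (p : (ℚ → ℚ) → Vec ℚ k) (p' : (ℚ → ℚ) → Vec ℚ ℓ)
    (τ τ' : Fin nE → ℚ → ℚ) (Q : Path) → Fin nE → Vec ℚ (k Data.Nat.+ ℓ)
  reductionWeight p p' τ τ' Q e =
    p (τ e) ++ (if does (e ∈? Q) then p' (τ' e) else 0ᵥ)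

  ParetoOptimalPath : ∀ {m} (w : Fin nE → Vec ℚ m) (s t : Fin nV) (P : Path) → Set
  ParetoOptimalPath w s t P =
    SimplePath s t P ×
    (∀ P′ → SimplePath s t P′ → sumVec w P′ ≤ᵥ sumVec w P → sumVec w P′ ≡ sumVec w P)

-- Simple s–t paths have fewer than |V| edges, so there are finitely many of them; pick one, P,
-- minimising lexicographically the pair (𝒞_P, sum of the coordinates of w(P)).  Since p and p′
-- are additive order embeddings, w(P′) ≤ w(P) says exactly that τ_{P′} ≤ τ_P and
-- τ′_{P′∩Q} ≤ τ′_{P∩Q}, i.e. P′ ⪯ P, so Pareto-conformity gives 𝒞_{P′} ≤ 𝒞_P.  Hence P′ is also
-- cost-optimal, the tie-break gives Σ w(P) ≤ Σ w(P′), and with w(P′) ≤ w(P) this forces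
-- w(P′) = w(P).  The tie-break makes the assumption that no two paths dominate each other
-- unnecessary; nor are d > 0, monotonicity, positivity or the range of x_P used.
module Submission where

open import Data.Bool using (true; false; if_then_else_)
open import Data.Empty using (⊥-elim)
open import Data.Fin using (Fin; zero; suc; toℕ)
import Data.Fin.Properties as FinP
open import Data.List using (List; []; _∷_; length; lookup; allFin; cartesianProductWith; filter)
open import Data.List.Membership.Propositional using (_∈_)
open import Data.List.Membership.Propositional.Properties
  using (∈-allFin; ∈-cartesianProductWith⁺; ∈-filter⁺; ∈-lookup)
open import Data.List.Relation.Unary.All as All using (All)
open import Data.List.Relation.Unary.All.Properties using (all-filter)
open import Data.List.Relation.Unary.AllPairs using (_∷_)
open import Data.List.Relation.Unary.Any using (here; there)
open import Data.List.Relation.Unary.Unique.Propositional using (Unique)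
open import Data.List.Relation.Unary.Unique.DecPropositional using (unique?)
open import Data.Nat as ℕ using (ℕ; zero; suc)
import Data.Nat.Properties as NP
open import Data.Product using (Σ; _×_; _,_)
open import Data.Product.Relation.Binary.Lex.NonStrict using (×-totalOrder)
import Data.Rational.Properties as QP
open import Algebra.Properties.Group QP.+-0-group using (//-rightDividesʳ)
open import Data.Rational using (ℚ; 0ℚ; _≤_; _<_; _+_; -_)
open import Data.Sum using (inj₁; inj₂)
open import Data.Vec as V using (Vec; []; _∷_)
import Data.Vec.Properties as VP
import Data.Vec.Relation.Binary.Pointwise.Inductive as PW
open import Defs
open import Function using (_∘_)
open import Relation.Binary.Bundles using (DecTotalOrder; TotalOrder)
open import Relation.Binary.PropositionalEquality
open import Relation.Nullary using (Dec; yes; no)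
open import Relation.Nullary.Decidable using (does; _×-dec_)

+-cancelʳ-≤ : ∀ {a b} c → a + c ≤ b + c → a ≤ b
+-cancelʳ-≤ {a} {b} c a+c≤b+c =
  subst₂ _≤_ (//-rightDividesʳ c a) (//-rightDividesʳ c b) (QP.+-monoˡ-≤ (- c) a+c≤b+c)

+-cancelˡ-≤ : ∀ {a b} c → c + a ≤ c + b → a ≤ b
+-cancelˡ-≤ {a} {b} c c+a≤c+b = +-cancelʳ-≤ c (subst₂ _≤_ (QP.+-comm c a) (QP.+-comm c b) c+a≤c+b)

+ᵥ-mono-≤ᵥ : ∀ {k} {u v u′ v′ : Vec ℚ k} → u ≤ᵥ v → u′ ≤ᵥ v′ → (u +ᵥ u′) ≤ᵥ (v +ᵥ v′)
+ᵥ-mono-≤ᵥ = PW.zipWith-cong QP.+-mono-≤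

+ᵥ-identityˡ : ∀ {k} (u : Vec ℚ k) → 0ᵥ +ᵥ u ≡ u
+ᵥ-identityˡ = VP.zipWith-identityˡ QP.+-identityˡ

+ᵥ-assoc : ∀ {k} (u v w : Vec ℚ k) → (u +ᵥ v) +ᵥ w ≡ u +ᵥ (v +ᵥ w)
+ᵥ-assoc = VP.zipWith-assoc QP.+-assoc

0ᵥ-++ : ∀ k ℓ → 0ᵥ {k ℕ.+ ℓ} ≡ 0ᵥ {k} V.++ 0ᵥ {ℓ}
0ᵥ-++ zero    ℓ = refl
0ᵥ-++ (suc k) ℓ = cong (0ℚ ∷_) (0ᵥ-++ k ℓ)

∑ᵥ : ∀ {k} → Vec ℚ k → ℚ
∑ᵥ []      = 0ℚ
∑ᵥ (a ∷ u) = a + ∑ᵥ u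

∑ᵥ-mono-≤ᵥ : ∀ {k} {u v : Vec ℚ k} → u ≤ᵥ v → ∑ᵥ u ≤ ∑ᵥ v
∑ᵥ-mono-≤ᵥ PW.[]           = QP.≤-refl
∑ᵥ-mono-≤ᵥ (a≤b PW.∷ u≤v) = QP.+-mono-≤ a≤b (∑ᵥ-mono-≤ᵥ u≤v)

≤ᵥ∧∑ᵥ-≥⇒≡ : ∀ {k} {u v : Vec ℚ k} → u ≤ᵥ v → ∑ᵥ v ≤ ∑ᵥ u → u ≡ v
≤ᵥ∧∑ᵥ-≥⇒≡ PW.[] _ = refl
≤ᵥ∧∑ᵥ-≥⇒≡ {u = a ∷ u} {b ∷ v} (a≤b PW.∷ u≤v) ∑v≤∑u =
  cong₂ _∷_ a≡b (≤ᵥ∧∑ᵥ-≥⇒≡ u≤v (+-cancelˡ-≤ a (subst (λ c → c + ∑ᵥ v ≤ a + ∑ᵥ u) (sym a≡b) ∑v≤∑u)))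
  where
  b≤a : b ≤ a
  b≤a = QP.≮⇒≥ λ a<b →
    QP.<-irrefl refl (QP.<-≤-trans (QP.+-mono-<-≤ a<b (∑ᵥ-mono-≤ᵥ u≤v)) ∑v≤∑u)

  a≡b : a ≡ b
  a≡b = QP.≤-antisym a≤b b≤a

module _ {A : Set} {S : A → Set} (f g : A → ℚ) (xs : List A)
         (complete : ∀ {y} → S y → y ∈ xs) (sound : All S xs) where

  private
    lexOrder = ×-totalOrder QP.≤-decTotalOrder (DecTotalOrder.totalOrder QP.≤-decTotalOrder)
    open import Data.List.Extrema lexOrder using (argmin; argmin-all; f[argmin]≤f[xs])
    open TotalOrder lexOrder using () renaming (_≤_ to _≤lex_)

    key : A → ℚ × ℚ
    key y = f y , g y

  lexMinimum : ∀ {z} → S z →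
    Σ A λ m → S m × (∀ y → S y → f m ≤ f y) × (∀ y → S y → f y ≤ f m → g m ≤ g y)
  lexMinimum {z} Sz = m , argmin-all key Sz sound , f-minimal , g-minimal-among-f-minimal
    where
    m : A
    m = argmin key z xs

    m≤lex : ∀ y → S y → key m ≤lex key y
    m≤lex y Sy = All.lookup (f[argmin]≤f[xs] z xs) (complete Sy)

    f-minimal : ∀ y → S y → f m ≤ f y
    f-minimal y Sy with m≤lex y Sy
    ... | inj₁ (fm≤fy , _) = fm≤fy
    ... | inj₂ (fm≡fy , _) = QP.≤-reflexive fm≡fy

    g-minimal-among-f-minimal : ∀ y → S y → f y ≤ f m → g m ≤ g y
    g-minimal-among-f-minimal y Sy fy≤fm with m≤lex y Sy
    ... | inj₁ (fm≤fy , fm≢fy) = ⊥-elim (fm≢fy (QP.≤-antisym fm≤fy fy≤fm))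
    ... | inj₂ (_ , gm≤gy)     = gm≤gy

module _ {A : Set} (xs : List A) where

  listsOfLength≤ : ℕ → List (List A)
  listsOfLength≤ zero    = [] ∷ []
  listsOfLength≤ (suc n) = [] ∷ cartesianProductWith _∷_ xs (listsOfLength≤ n)

  ∈-listsOfLength≤ : (∀ x → x ∈ xs) → ∀ n (ys : List A) → length ys ℕ.≤ n → ys ∈ listsOfLength≤ n
  ∈-listsOfLength≤ all∈ zero    []       _ = here refl
  ∈-listsOfLength≤ all∈ (suc n) []       _ = here refl
  ∈-listsOfLength≤ all∈ (suc n) (y ∷ ys) (ℕ.s≤s |ys|≤n) =
    there (∈-cartesianProductWith⁺ _∷_ (all∈ y) (∈-listsOfLength≤ all∈ n ys |ys|≤n))

lookup-injective : ∀ {A : Set} {xs : List A} → Unique xs →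
  ∀ (i j : Fin (length xs)) → toℕ i ℕ.< toℕ j → lookup xs i ≢ lookup xs j
lookup-injective (x∉xs ∷ _) zero    (suc j) _           = All.lookup x∉xs (∈-lookup j)
lookup-injective (_ ∷ uniq) (suc i) (suc j) (ℕ.s≤s i<j) = lookup-injective uniq i j i<j

Unique⇒length≤ : ∀ {n} (xs : List (Fin n)) → Unique xs → length xs ℕ.≤ n
Unique⇒length≤ {n} xs uniq with length xs ℕ.≤? n
... | yes |xs|≤n = |xs|≤n
... | no  |xs|≰n with FinP.pigeonhole (NP.≰⇒> |xs|≰n) (lookup xs)
...   | i , j , i<j , same = ⊥-elim (lookup-injective uniq i j i<j same)

module _ (G : Digraph) where
  open Digraph G
  open import Data.List.Membership.DecPropositional (FinP._≟_ {nE}) using (_∈?_)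

  isWalk? : ∀ u v P → Dec (IsWalk G u v P)
  isWalk? u v []       = u FinP.≟ v
  isWalk? u v (e ∷ es) = (src e FinP.≟ u) ×-dec isWalk? (tgt e) v es

  simplePath? : ∀ s t P → Dec (SimplePath G s t P)
  simplePath? s t P = isWalk? s t P ×-dec unique? FinP._≟_ (vertices G s P)

  length-vertices : ∀ u P → length (vertices G u P) ≡ suc (length P)
  length-vertices u []       = refl
  length-vertices u (e ∷ es) = cong suc (length-vertices (tgt e) es)

  simplePath-length< : ∀ {s t P} → SimplePath G s t P → length P ℕ.< nV
  simplePath-length< {s} {t} {P} (_ , uniq) =
    subst (ℕ._≤ nV) (length-vertices s P) (Unique⇒length≤ (vertices G s P) uniq)

  simplePaths : Fin nV → Fin nV → List (Path G)
  simplePaths s t = filter (simplePath? s t) (listsOfLength≤ (allFin nE) nV)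

  ∈-simplePaths : ∀ {s t P} → SimplePath G s t P → P ∈ simplePaths s t
  ∈-simplePaths {s} {t} {P} simple = ∈-filter⁺ (simplePath? s t)
    (∈-listsOfLength≤ (allFin nE) ∈-allFin nV P (NP.<⇒≤ (simplePath-length< simple))) simple

  simplePaths-simple : ∀ s t → All (SimplePath G s t) (simplePaths s t)
  simplePaths-simple s t = all-filter (simplePath? s t) (listsOfLength≤ (allFin nE) nV)

  sumVec-++ : ∀ {k ℓ} (a : Fin nE → Vec ℚ k) (b : Fin nE → Vec ℚ ℓ) P →
    sumVec G (λ e → a e V.++ b e) P ≡ sumVec G a P V.++ sumVec G b P
  sumVec-++ {k} {ℓ} a b []      = 0ᵥ-++ k ℓ
  sumVec-++ a b (e ∷ P) = begin
    (a e V.++ b e) +ᵥ sumVec G (λ e → a e V.++ b e) P ≡⟨ cong ((a e V.++ b e) +ᵥ_) (sumVec-++ a b P) ⟩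
    (a e V.++ b e) +ᵥ (sumVec G a P V.++ sumVec G b P) ≡⟨ VP.zipWith-++ _+_ (a e) (b e) (sumVec G a P) (sumVec G b P) ⟩
    (a e +ᵥ sumVec G a P) V.++ (b e +ᵥ sumVec G b P)   ∎
    where open ≡-Reasoning

  sumVec-∩ : ∀ {ℓ} (b : Fin nE → Vec ℚ ℓ) Q P →
    sumVec G (λ e → if does (e ∈? Q) then b e else 0ᵥ) P ≡ sumVec G b (_∩_ G P Q)
  sumVec-∩ b Q []      = refl
  sumVec-∩ b Q (e ∷ P) with does (e ∈? Q)
  ... | true  = cong (b e +ᵥ_) (sumVec-∩ b Q P)
  ... | false = trans (+ᵥ-identityˡ _) (sumVec-∩ b Q P)

  -- The sum started at h rather than at 0, since the class T need not contain the zero function.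
  sumFunFrom : (ℚ → ℚ) → (Fin nE → ℚ → ℚ) → Path G → ℚ → ℚ
  sumFunFrom h f []       = h
  sumFunFrom h f (e ∷ es) = f e ⊕ sumFunFrom h f es

  sumFunFrom-apply : ∀ h f A x → sumFunFrom h f A x ≡ sumFun G f A x + h x
  sumFunFrom-apply h f []       x = sym (QP.+-identityˡ (h x))
  sumFunFrom-apply h f (e ∷ es) x =
    trans (cong (f e x +_) (sumFunFrom-apply h f es x)) (sym (QP.+-assoc (f e x) _ (h x)))

  module _ {d k T p} (R : ParetoRep d k T p) {f : Fin nE → ℚ → ℚ} (f∈T : ∀ e → T (f e))
           {h : ℚ → ℚ} (h∈T : T h) where
    open ParetoRep R

    sumFunFrom∈T : ∀ A → T (sumFunFrom h f A)
    sumFunFrom∈T []       = h∈T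
    sumFunFrom∈T (e ∷ es) = closed _ _ (f∈T e) (sumFunFrom∈T es)

    p-sumFunFrom : ∀ A → p (sumFunFrom h f A) ≡ sumVec G (p ∘ f) A +ᵥ p h
    p-sumFunFrom []       = sym (+ᵥ-identityˡ (p h))
    p-sumFunFrom (e ∷ es) = begin
      p (f e ⊕ sumFunFrom h f es)                  ≡⟨ additive _ _ (f∈T e) (sumFunFrom∈T es) ⟩
      p (f e) +ᵥ p (sumFunFrom h f es)             ≡⟨ cong (p (f e) +ᵥ_) (p-sumFunFrom es) ⟩
      p (f e) +ᵥ (sumVec G (p ∘ f) es +ᵥ p h)      ≡⟨ +ᵥ-assoc (p (f e)) _ (p h) ⟨
      (p (f e) +ᵥ sumVec G (p ∘ f) es) +ᵥ p h      ∎
      where open ≡-Reasoning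

    sumVec-≤ᵥ⇒sumFun-≤ : ∀ A B → sumVec G (p ∘ f) A ≤ᵥ sumVec G (p ∘ f) B →
      FunLe d (sumFun G f A) (sumFun G f B)
    sumVec-≤ᵥ⇒sumFun-≤ A B A≤B x 0≤x x≤d = +-cancelʳ-≤ (h x)
      (subst₂ _≤_ (sumFunFrom-apply h f A x) (sumFunFrom-apply h f B x)
        (order← _ _ (sumFunFrom∈T A) (sumFunFrom∈T B)
          (subst₂ _≤ᵥ_ (sym (p-sumFunFrom A)) (sym (p-sumFunFrom B))
            (+ᵥ-mono-≤ᵥ A≤B (PW.refl QP.≤-refl)))
          x 0≤x x≤d))

module Reduction (G : Digraph) {d : ℚ} (τ τ' : Fin (Digraph.nE G) → ℚ → ℚ)
  (τ-deriv : ∀ e → HasDerivOn d (τ e) (τ' e)) (Q : Path G)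
  {k ℓ : ℕ} {T : (ℚ → ℚ) → Set} {p : (ℚ → ℚ) → Vec ℚ k} {p' : (ℚ → ℚ) → Vec ℚ ℓ}
  (R : ParetoRep d k T p) (R' : ParetoRep d ℓ (Derivs d T) p') (τ∈T : ∀ e → T (τ e)) where
  open Digraph G
  open import Data.List.Membership.DecPropositional (FinP._≟_ {nE}) using (_∈?_)

  valueWeight : Fin nE → Vec ℚ k
  valueWeight = p ∘ τ

  slopeWeight : Fin nE → Vec ℚ ℓ
  slopeWeight e = if does (e ∈? Q) then p' (τ' e) else 0ᵥ

  weight : Path G → Vec ℚ (k ℕ.+ ℓ)
  weight = sumVec G (reductionWeight G p p' τ τ' Q)

  weight-split : ∀ P → weight P ≡ sumVec G valueWeight P V.++ sumVec G slopeWeight P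
  weight-split = sumVec-++ G valueWeight slopeWeight

  τ'∈Derivs : ∀ e → Derivs d T (τ' e)
  τ'∈Derivs e = τ e , τ∈T e , τ-deriv e

  -- Any edge e₀ will do: it only supplies the base functions τ e₀ ∈ T and τ' e₀ for sumFunFrom.
  weight-≤ᵥ⇒Dominates : Fin nE → ∀ P₁ P₂ → weight P₁ ≤ᵥ weight P₂ → Dominates G τ τ' d Q P₁ P₂
  weight-≤ᵥ⇒Dominates e₀ P₁ P₂ P₁≤P₂ =
    sumVec-≤ᵥ⇒sumFun-≤ G R τ∈T (τ∈T e₀) P₁ P₂ values≤ ,
    sumVec-≤ᵥ⇒sumFun-≤ G R' τ'∈Derivs {h = τ' e₀} (τ'∈Derivs e₀) (_∩_ G P₁ Q) (_∩_ G P₂ Q)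
      (subst₂ _≤ᵥ_ (sumVec-∩ G (p' ∘ τ') Q P₁) (sumVec-∩ G (p' ∘ τ') Q P₂) slopes≤)
    where
    split≤ : (sumVec G valueWeight P₁ V.++ sumVec G slopeWeight P₁)
          ≤ᵥ (sumVec G valueWeight P₂ V.++ sumVec G slopeWeight P₂)
    split≤ = subst₂ _≤ᵥ_ (weight-split P₁) (weight-split P₂) P₁≤P₂

    values≤ : sumVec G valueWeight P₁ ≤ᵥ sumVec G valueWeight P₂
    values≤ = PW.++ˡ⁻ _ _ split≤

    slopes≤ : sumVec G slopeWeight P₁ ≤ᵥ sumVec G slopeWeight P₂
    slopes≤ = PW.++ʳ⁻ (sumVec G valueWeight P₁) (sumVec G valueWeight P₂) split≤

  weight-≤ᵥ⇒cost-≤ : ∀ {s t} (cost : Path G → ℚ) →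
    (∀ P₁ P₂ → SimplePath G s t P₁ → SimplePath G s t P₂ →
      Dominates G τ τ' d Q P₁ P₂ → cost P₁ ≤ cost P₂) →
    ∀ P₁ P₂ → SimplePath G s t P₁ → SimplePath G s t P₂ → weight P₁ ≤ᵥ weight P₂ → cost P₁ ≤ cost P₂
  weight-≤ᵥ⇒cost-≤ cost conform []          []          _  _  _  = QP.≤-refl
  weight-≤ᵥ⇒cost-≤ cost conform P₁@(e ∷ _) P₂          s₁ s₂ ≤w =
    conform P₁ P₂ s₁ s₂ (weight-≤ᵥ⇒Dominates e P₁ P₂ ≤w)
  weight-≤ᵥ⇒cost-≤ cost conform []          P₂@(e ∷ _) s₁ s₂ ≤w =
    conform [] P₂ s₁ s₂ (weight-≤ᵥ⇒Dominates e [] P₂ ≤w)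

theorem3 : (G : Digraph) (s t : Fin (Digraph.nV G)) (d : ℚ) → 0ℚ < d →
    (τ τ' : Fin (Digraph.nE G) → ℚ → ℚ) →
    (∀ e → MonotoneOn d (τ e)) →
    (∀ e → PositiveOn d (τ e)) →
    (∀ e → HasDerivOn d (τ e) (τ' e)) →
    (Q : Path G) → SimplePath G s t Q →
    (x : Path G → ℚ) →
    (∀ P → SimplePath G s t P → 0ℚ ≤ x P × x P ≤ d) →
    (∀ P₁ P₂ → SimplePath G s t P₁ → SimplePath G s t P₂ →
      Dominates G τ τ' d Q P₁ P₂ →
      costAt G τ d Q P₁ (x P₁) ≤ costAt G τ d Q P₂ (x P₂)) →
    (∀ P₁ P₂ → SimplePath G s t P₁ → SimplePath G s t P₂ →
      Dominates G τ τ' d Q P₁ P₂ → Dominates G τ τ' d Q P₂ P₁ → P₁ ≡ P₂) →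
    (k ℓ : ℕ) (T : (ℚ → ℚ) → Set) (p : (ℚ → ℚ) → Vec ℚ k) (p' : (ℚ → ℚ) → Vec ℚ ℓ) →
    ParetoRep d k T p →
    ParetoRep d ℓ (Derivs d T) p' →
    (∀ e → T (τ e)) →
    Σ (Path G) λ P →
      ParetoOptimalPath G (reductionWeight G p p' τ τ' Q) s t P ×
      (∀ P′ → SimplePath G s t P′ → costAt G τ d Q P (x P) ≤ costAt G τ d Q P′ (x P′))
theorem3 G s t d _ τ τ' _ _ τ-deriv Q Q-simple x _ conform _ k ℓ T p p' R R' τ∈T =
  let open Reduction G τ τ' τ-deriv Q R R' τ∈T
      cost : Path G → ℚ
      cost P = costAt G τ d Q P (x P)
      P , P-simple , cost-minimal , weight-minimal =
        lexMinimum cost (∑ᵥ ∘ weight) (simplePaths G s t) (∈-simplePaths G)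
          (simplePaths-simple G s t) Q-simple
      nondominated : ∀ P′ → SimplePath G s t P′ → weight P′ ≤ᵥ weight P → weight P′ ≡ weight P
      nondominated P′ P′-simple P′≤P = ≤ᵥ∧∑ᵥ-≥⇒≡ P′≤P (weight-minimal P′ P′-simple
        (weight-≤ᵥ⇒cost-≤ cost conform P′ P P′-simple P-simple P′≤P))
  in  P , (P-simple , nondominated) , cost-minimal
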